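{- Let $r\geq 3$. Then for all $d\geq r$, \[M_r(d)\leq (4r+2)\frac{2^d}{d}.\]
   Context: Let $Q_d=\{0,1\}^d$ be the $d$-dimensional hypercube graph (vertices adjacent iff they differ in exactly one coordinate). In $r$-neighbour bootstrap percolation on $Q_d$, given an initial infected set $A_0$, one sets $A_{t+1}=A_t\cup\{v : v \text{ has at least } r \text{ neighbours in } A_t\}$ for $t\ge 0$; $A_0$ percolates if $A_t=\{0,1\}^d$ for some $t$, the least such $t$ being its percolation time. $M_r(d)$ is the maximal percolation time over all percolating sets $A_0\subseteq\{0,1\}^d$. -}

module Defs where

open import Data.Bool using (Bool; true; false; _∨_; if_then_else_; not)
open import Data.Nat using (ℕ; zero; suc; _≤ᵇ_; _<_)
open import Data.Fin using (Fin)
open import Data.Vec using (Vec; updateAt)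
open import Data.List using (List; map; allFin)
open import Data.Nat.ListAction using (sum)
open import Relation.Binary.PropositionalEquality using (_≡_)
open import Relation.Nullary using (¬_)

Vertex : ℕ → Set
Vertex d = Vec Bool d

-- The neighbour of v obtained by flipping coordinate i.
-- The neighbours of v in Q_d are exactly flipAt i v for i : Fin d.
flipAt : ∀ {d} → Fin d → Vertex d → Vertex d
flipAt i v = updateAt v i not

VSet : ℕ → Set
VSet d = Vertex d → Bool

infectedNeighbours : ∀ {d} → VSet d → Vertex d → ℕ
infectedNeighbours {d} A v =
  sum (map (λ i → if A (flipAt i v) then 1 else 0) (allFin d))

step : ∀ {d} → ℕ → VSet d → VSet d
step r A v = A v ∨ (r ≤ᵇ infectedNeighbours A v)

infectedAt : ∀ {d} → ℕ → VSet d → ℕ → VSet d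
infectedAt r A₀ zero    = A₀
infectedAt r A₀ (suc t) = step r (infectedAt r A₀ t)

FullyInfectedAt : ∀ {d} → ℕ → VSet d → ℕ → Set
FullyInfectedAt {d} r A₀ t = (v : Vertex d) → infectedAt r A₀ t v ≡ true

PercolationTime : ∀ {d} → ℕ → VSet d → ℕ → Set
PercolationTime r A₀ T =
  FullyInfectedAt r A₀ T × ((t : ℕ) → t < T → ¬ FullyInfectedAt r A₀ t)
  where open import Data.Product using (_×_)

-- For each step s < T pick a vertex v_s infected exactly at time s + 1; the v_s are distinct, so
-- T ≤ 2^d. Split the d neighbours of v_s according to whether they lie in A_{s-1}: since v_s ∉ A_s,
-- at most r of them do. The remaining pairs (v_s, w) are counted from the side of w. The steps s
-- with w ∉ A_{s-1} form an initial segment s ≤ m, and as w ∉ A_{m-1}, w had fewer than r neighbours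
-- in A_{m-2}, which contains every v_s with s < m - 2; so w is adjacent to at most r + 2 of the v_s
-- counted. Hence T d ≤ T r + (r + 2) 2^d ≤ (2r + 2) 2^d.
module Submission where

open import Data.Bool using (Bool; true; false; not; _∧_; _∨_; if_then_else_)
import Data.Bool.Properties as Bool
open import Data.Empty using (⊥-elim)
open import Data.Fin as Fin using (Fin)
open import Data.List using (List; []; _∷_; _++_; map; allFin; downFrom; length)
open import Data.List.Properties
  using (map-cong; map-∘; map-++; map-tabulate; length-downFrom; length-tabulate)
open import Data.List.Membership.Propositional using (_∈_)
open import Data.List.Membership.Propositional.Properties using (∈-downFrom⁻)
open import Data.List.Relation.Unary.Any using (here; there)
open import Data.Nat using (ℕ; zero; suc; _+_; _*_; _∸_; _^_; _≤_; _<_; _≤ᵇ_; z≤n)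
open import Data.Nat.ListAction using (sum)
open import Data.Nat.ListAction.Properties using (sum-++)
open import Data.Nat.Properties
open import Data.Nat.Tactic.RingSolver using (solve-∀)
open import Algebra.Properties.CommutativeSemigroup +-commutativeSemigroup using (interchange)
open import Data.Product using (_×_; _,_; proj₁; proj₂)
open import Data.Vec using ([]; _∷_)
open import Data.Vec.Properties using (≡-dec)
open import Function using (_∘_; id)
open import Relation.Binary.Definitions using (DecidableEquality)
open import Relation.Binary.PropositionalEquality
open import Relation.Nullary using (does; yes; no)

open import Defs

∑ : {A : Set} → List A → (A → ℕ) → ℕ
∑ xs f = sum (map f xs)

syntax ∑ xs (λ x → e) = ∑[ x ∈ xs ] e

module _ {A : Set} where

  ∑-cong : {f g : A → ℕ} → f ≗ g → ∀ xs → ∑ xs f ≡ ∑ xs g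
  ∑-cong f≗g xs = cong sum (map-cong f≗g xs)

  ∑-mono-∈ : {f g : A → ℕ} → ∀ xs → (∀ {x} → x ∈ xs → f x ≤ g x) → ∑ xs f ≤ ∑ xs g
  ∑-mono-∈ []       f≤g = z≤n
  ∑-mono-∈ (x ∷ xs) f≤g = +-mono-≤ (f≤g (here refl)) (∑-mono-∈ xs (f≤g ∘ there))

  ∑-mono : {f g : A → ℕ} → (∀ x → f x ≤ g x) → ∀ xs → ∑ xs f ≤ ∑ xs g
  ∑-mono f≤g xs = ∑-mono-∈ xs (λ {x} _ → f≤g x)

  ∑-const : (xs : List A) (c : ℕ) → ∑[ x ∈ xs ] c ≡ length xs * c
  ∑-const []       c = refl
  ∑-const (x ∷ xs) c = cong (c +_) (∑-const xs c)

  ∑-zero : (xs : List A) → ∑[ x ∈ xs ] 0 ≡ 0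
  ∑-zero xs = trans (∑-const xs 0) (*-zeroʳ (length xs))

  ∑-distrib-+ : ∀ (f g : A → ℕ) xs → ∑[ x ∈ xs ] (f x + g x) ≡ ∑ xs f + ∑ xs g
  ∑-distrib-+ f g []       = refl
  ∑-distrib-+ f g (x ∷ xs) =
    trans (cong (f x + g x +_) (∑-distrib-+ f g xs)) (interchange (f x) (g x) (∑ xs f) (∑ xs g))

  ∑-distribʳ-* : ∀ (f : A → ℕ) c xs → ∑[ x ∈ xs ] (f x * c) ≡ ∑ xs f * c
  ∑-distribʳ-* f c []       = refl
  ∑-distribʳ-* f c (x ∷ xs) =
    trans (cong (f x * c +_) (∑-distribʳ-* f c xs)) (sym (*-distribʳ-+ c (f x) (∑ xs f)))

∑-comm : {A B : Set} (xs : List A) (ys : List B) (f : A → B → ℕ) →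
         ∑[ x ∈ xs ] ∑[ y ∈ ys ] f x y ≡ ∑[ y ∈ ys ] ∑[ x ∈ xs ] f x y
∑-comm []       ys f = sym (∑-zero ys)
∑-comm (x ∷ xs) ys f = trans (cong (∑ ys (f x) +_) (∑-comm xs ys f))
                             (sym (∑-distrib-+ (f x) (λ y → ∑[ x ∈ xs ] f x y) ys))

∑-downFrom-const : ∀ k c → ∑[ s ∈ downFrom k ] c ≡ k * c
∑-downFrom-const k c = trans (∑-const (downFrom k) c) (cong (_* c) (length-downFrom k))

∑-allFin-suc : ∀ {d} (f : Fin (suc d) → ℕ) →
               ∑ (allFin (suc d)) f ≡ f Fin.zero + ∑ (allFin d) (f ∘ Fin.suc)
∑-allFin-suc {d} f = cong (f Fin.zero +_)
  (trans (cong sum (map-tabulate Fin.suc f)) (sym (cong sum (map-tabulate id (f ∘ Fin.suc)))))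

not-∧-true : ∀ {a b} → not a ∧ b ≡ true → a ≡ false × b ≡ true
not-∧-true {false} {true} _ = refl , refl

χ : Bool → ℕ
χ b = if b then 1 else 0

χ≤1 : ∀ b → χ b ≤ 1
χ≤1 true  = ≤-refl
χ≤1 false = z≤n

χ-mono : ∀ {a b} → (a ≡ true → b ≡ true) → χ a ≤ χ b
χ-mono {true}  a⇒b rewrite a⇒b refl = ≤-refl
χ-mono {false} a⇒b = z≤n

χ+χ-not : ∀ b → χ b + χ (not b) ≡ 1
χ+χ-not true  = refl
χ+χ-not false = refl

*-χ≤ : ∀ m b → m * χ b ≤ m
*-χ≤ m true  = ≤-reflexive (*-identityʳ m)
*-χ≤ m false = ≤-trans (≤-reflexive (*-zeroʳ m)) z≤n

_≟ᵛ_ : ∀ {d} → DecidableEquality (Vertex d)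
u ≟ᵛ w = ≡-dec Bool._≟_ u w

δ : ∀ {d} → Vertex d → Vertex d → ℕ
δ u w = χ (does (u ≟ᵛ w))

allVertices : ∀ d → List (Vertex d)
allVertices zero    = [] ∷ []
allVertices (suc d) = map (false ∷_) (allVertices d) ++ map (true ∷_) (allVertices d)

∑-allVertices-suc : ∀ {d} (f : Vertex (suc d) → ℕ) →
                    ∑ (allVertices (suc d)) f
                    ≡ ∑[ w ∈ allVertices d ] f (false ∷ w) + ∑[ w ∈ allVertices d ] f (true ∷ w)
∑-allVertices-suc {d} f = begin
  sum (map f (map (false ∷_) V ++ map (true ∷_) V))
    ≡⟨ cong sum (map-++ f (map (false ∷_) V) _) ⟩
  sum (map f (map (false ∷_) V) ++ map f (map (true ∷_) V))
    ≡⟨ sum-++ (map f (map (false ∷_) V)) _ ⟩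
  sum (map f (map (false ∷_) V)) + sum (map f (map (true ∷_) V))
    ≡⟨ cong₂ _+_ (cong sum (map-∘ V)) (cong sum (map-∘ V)) ⟨
  ∑[ w ∈ V ] f (false ∷ w) + ∑[ w ∈ V ] f (true ∷ w)
    ∎
  where
  open ≡-Reasoning
  V = allVertices d

∑-allVertices-const : ∀ d c → ∑[ w ∈ allVertices d ] c ≡ 2 ^ d * c
∑-allVertices-const zero    c = refl
∑-allVertices-const (suc d) c = begin
  ∑[ w ∈ allVertices (suc d) ] c                       ≡⟨ ∑-allVertices-suc {d} (λ _ → c) ⟩
  ∑[ w ∈ allVertices d ] c + ∑[ w ∈ allVertices d ] c  ≡⟨ cong₂ _+_ IH IH ⟩
  2 ^ d * c + 2 ^ d * c                                ≡⟨ cong (2 ^ d * c +_) (+-identityʳ (2 ^ d * c)) ⟨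
  2 * (2 ^ d * c)                                      ≡⟨ *-assoc 2 (2 ^ d) c ⟨
  2 ^ suc d * c                                        ∎
  where
  open ≡-Reasoning
  IH = ∑-allVertices-const d c

∑-δ : ∀ {d} (u : Vertex d) (g : Vertex d → ℕ) → ∑[ w ∈ allVertices d ] (δ u w * g w) ≡ g u
∑-δ         []          g = trans (+-identityʳ _) (+-identityʳ (g []))
∑-δ {suc d} (false ∷ u) g = begin
  ∑ (allVertices (suc d)) (λ w → δ (false ∷ u) w * g w)
    ≡⟨ ∑-allVertices-suc {d} _ ⟩
  ∑[ w ∈ allVertices d ] (δ u w * g (false ∷ w)) + ∑[ w ∈ allVertices d ] 0
    ≡⟨ cong₂ _+_ (∑-δ u _) (∑-zero (allVertices d)) ⟩
  g (false ∷ u) + 0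
    ≡⟨ +-identityʳ _ ⟩
  g (false ∷ u)
    ∎
  where open ≡-Reasoning
∑-δ {suc d} (true ∷ u)  g = begin
  ∑ (allVertices (suc d)) (λ w → δ (true ∷ u) w * g w)
    ≡⟨ ∑-allVertices-suc {d} _ ⟩
  ∑[ w ∈ allVertices d ] 0 + ∑[ w ∈ allVertices d ] (δ u w * g (true ∷ w))
    ≡⟨ cong₂ _+_ (∑-zero (allVertices d)) (∑-δ u _) ⟩
  g (true ∷ u)
    ∎
  where open ≡-Reasoning

∑-fibres : ∀ {A : Set} {d} (xs : List A) (φ : A → Vertex d) (g : A → Vertex d → ℕ) →
           ∑[ x ∈ xs ] g x (φ x) ≡ ∑[ w ∈ allVertices d ] ∑[ x ∈ xs ] (δ (φ x) w * g x w)
∑-fibres {d = d} xs φ g =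
  trans (∑-cong (λ x → sym (∑-δ (φ x) (g x))) xs)
        (∑-comm xs (allVertices d) (λ x w → δ (φ x) w * g x w))

δ-flipAt : ∀ {d} (i : Fin d) (v w : Vertex d) → δ (flipAt i v) w ≡ δ v (flipAt i w)
δ-flipAt i v w = cong χ (does-flipAt i v w)
  where
  does-flipAt : ∀ {d} (i : Fin d) (v w : Vertex d) →
                does (flipAt i v ≟ᵛ w) ≡ does (v ≟ᵛ flipAt i w)
  does-flipAt Fin.zero    (true ∷ v)  (true ∷ w)  = refl
  does-flipAt Fin.zero    (true ∷ v)  (false ∷ w) = refl
  does-flipAt Fin.zero    (false ∷ v) (true ∷ w)  = refl
  does-flipAt Fin.zero    (false ∷ v) (false ∷ w) = refl
  does-flipAt (Fin.suc i) (x ∷ v)     (y ∷ w)     = cong (does (x Bool.≟ y) ∧_) (does-flipAt i v w)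

adjacency : ∀ {d} → Vertex d → Vertex d → ℕ
adjacency {d} v w = ∑[ i ∈ allFin d ] δ (flipAt i v) w

adjacency≤1 : ∀ {d} (v w : Vertex d) → adjacency v w ≤ 1
adjacency≤1         []      []      = z≤n
adjacency≤1 {suc d} (x ∷ v) (y ∷ w) =
  ≤-trans (≤-reflexive (∑-allFin-suc (λ i → δ (flipAt i (x ∷ v)) (y ∷ w)))) (by-heads x y)
  where
  onlyHead : δ v w + ∑[ i ∈ allFin d ] 0 ≤ 1
  onlyHead = ≤-trans (≤-reflexive (trans (cong (δ v w +_) (∑-zero (allFin d))) (+-identityʳ _))) (χ≤1 _)

  by-heads : ∀ x y → δ (not x ∷ v) (y ∷ w) + ∑[ i ∈ allFin d ] δ (x ∷ flipAt i v) (y ∷ w) ≤ 1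
  by-heads true  true  = adjacency≤1 v w
  by-heads false false = adjacency≤1 v w
  by-heads true  false = onlyHead
  by-heads false true  = onlyHead

infectedNeighbours-complement : ∀ {d} (X : VSet d) (v : Vertex d) →
                                infectedNeighbours X v + infectedNeighbours (not ∘ X) v ≡ d
infectedNeighbours-complement {d} X v = begin
  infectedNeighbours X v + infectedNeighbours (not ∘ X) v
    ≡⟨ ∑-distrib-+ (χ ∘ X ∘ flip) (χ ∘ not ∘ X ∘ flip) (allFin d) ⟨
  ∑[ i ∈ allFin d ] (χ (X (flip i)) + χ (not (X (flip i))))
    ≡⟨ ∑-cong (χ+χ-not ∘ X ∘ flip) (allFin d) ⟩
  ∑[ i ∈ allFin d ] 1    ≡⟨ ∑-const (allFin d) 1 ⟩
  length (allFin d) * 1  ≡⟨ *-identityʳ _ ⟩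
  length (allFin d)      ≡⟨ length-tabulate id ⟩
  d                      ∎
  where
  open ≡-Reasoning
  flip : Fin d → Vertex d
  flip i = flipAt i v

∑-infectedNeighbours : ∀ {A : Set} {d} (xs : List A) (v : A → Vertex d) (B : A → VSet d) →
                       ∑[ x ∈ xs ] infectedNeighbours (B x) (v x)
                       ≡ ∑[ w ∈ allVertices d ] ∑[ x ∈ xs ] (adjacency (v x) w * χ (B x w))
∑-infectedNeighbours {d = d} xs v B =
  trans (∑-cong fibres xs) (∑-comm xs (allVertices d) (λ x w → adjacency (v x) w * χ (B x w)))
  where
  fibres : ∀ x → infectedNeighbours (B x) (v x) ≡ ∑[ w ∈ allVertices d ] (adjacency (v x) w * χ (B x w))
  fibres x = trans (∑-fibres (allFin d) (λ i → flipAt i (v x)) (λ _ w → χ (B x w)))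
                   (∑-cong (λ w → ∑-distribʳ-* (λ i → δ (flipAt i (v x)) w) (χ (B x w)) (allFin d))
                           (allVertices d))

search : ∀ {d} → (Vertex d → Bool) → Vertex d
search {zero}  P = []
search {suc d} P = if P (true ∷ w) then true ∷ w else false ∷ search (P ∘ (false ∷_))
  where
  w : Vertex d
  w = search (P ∘ (true ∷_))

search-sound : ∀ {d} (P : Vertex d → Bool) {u} → P u ≡ true → P (search P) ≡ true
search-sound {zero}  P {[]}    Pu = Pu
search-sound {suc d} P {b ∷ u} Pu with P (true ∷ search (P ∘ (true ∷_))) in found | b
... | true  | _     = found
... | false | true  with () ← trans (sym found) (search-sound (P ∘ (true ∷_)) Pu)
... | false | false = search-sound (P ∘ (false ∷_)) Pu

search-complete : ∀ {d} (P : Vertex d → Bool) → P (search P) ≡ false → ∀ u → P u ≡ false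
search-complete P none u with P u in Pu
... | false = refl
... | true  with () ← trans (sym none) (search-sound P Pu)

≤ᵇ-false⇒> : ∀ {m n} → (m ≤ᵇ n) ≡ false → n < m
≤ᵇ-false⇒> m≰ᵇn = ≰⇒> (λ m≤n → subst Data.Bool.T m≰ᵇn (≤⇒≤ᵇ m≤n))

step-inflationary : ∀ {d} r (X : VSet d) {u} → X u ≡ true → step r X u ≡ true
step-inflationary r X Xu rewrite Xu = refl

step-cong : ∀ {d} r {X Y : VSet d} → X ≗ Y → step r X ≗ step r Y
step-cong {d} r X≗Y u =
  cong₂ (λ a n → a ∨ (r ≤ᵇ n)) (X≗Y u) (∑-cong (λ i → cong χ (X≗Y (flipAt i u))) (allFin d))

step-false⇒infectedNeighbours< : ∀ {d} r (X : VSet d) u →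
                                 step r X u ≡ false → infectedNeighbours X u < r
step-false⇒infectedNeighbours< r X u healthy with X u
... | false = ≤ᵇ-false⇒> healthy

module Percolation {d : ℕ} (r : ℕ) (A₀ : VSet d) where

  A : ℕ → VSet d
  A = infectedAt r A₀

  A-stable : ∀ s → A (suc s) ≗ A s → ∀ j → A (j + s) ≗ A s
  A-stable s stable zero    u = refl
  A-stable s stable (suc j) u = trans (step-cong r (A-stable s stable j) u) (stable u)

  -- A_{s-1}, with A_{-1} = ∅
  infectedBefore : ℕ → VSet d
  infectedBefore zero    _ = false
  infectedBefore (suc s)   = A s

  fresh : ℕ → Vertex d → Bool
  fresh s u = not (A s u) ∧ A (suc s) u

  noneFresh⇒stable : ∀ s → (∀ u → fresh s u ≡ false) → A (suc s) ≗ A s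
  noneFresh⇒stable s none u = unchanged (A s u) (A (suc s) u) (step-inflationary r (A s)) (none u)
    where
    unchanged : ∀ a b → (a ≡ true → b ≡ true) → not a ∧ b ≡ false → b ≡ a
    unchanged true  _ a⇒b _   = a⇒b refl
    unchanged false _ _   b≡false = b≡false

  module Percolating {T : ℕ} (perc : PercolationTime r A₀ T) where

    newlyInfected : ℕ → Vertex d
    newlyInfected s = search (fresh s)

    newlyInfected-fresh : ∀ {s} → s < T → fresh s (newlyInfected s) ≡ true
    newlyInfected-fresh {s} s<T with fresh s (newlyInfected s) in found
    ... | true  = refl
    ... | false = ⊥-elim (proj₂ perc s s<T fullyInfectedAt-s)
      where
      fullyInfectedAt-s : FullyInfectedAt r A₀ s
      fullyInfectedAt-s u = begin
        A s u            ≡⟨ A-stable s (noneFresh⇒stable s noneFresh) (T ∸ s) u ⟨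
        A (T ∸ s + s) u  ≡⟨ cong (λ t → A t u) (m∸n+n≡m (<⇒≤ s<T)) ⟩
        A T u            ≡⟨ proj₁ perc u ⟩
        true             ∎
        where
        open ≡-Reasoning
        noneFresh : ∀ u → fresh s u ≡ false
        noneFresh = search-complete (fresh s) found

    newlyInfected-healthy : ∀ {s} → s < T → A s (newlyInfected s) ≡ false
    newlyInfected-healthy = proj₁ ∘ not-∧-true ∘ newlyInfected-fresh

    newlyInfected-infected : ∀ {s} → s < T → A (suc s) (newlyInfected s) ≡ true
    newlyInfected-infected = proj₂ ∘ not-∧-true ∘ newlyInfected-fresh

    timesChosen : ℕ → Vertex d → ℕ
    timesChosen k u = ∑[ s ∈ downFrom k ] δ (newlyInfected s) u

    timesChosen≤infected : ∀ {k} → k ≤ T → ∀ u → timesChosen k u ≤ χ (A k u)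
    timesChosen≤infected {zero}  _   u = z≤n
    timesChosen≤infected {suc k} k<T u with newlyInfected k ≟ᵛ u
    ... | yes refl = begin
      1 + timesChosen k u  ≤⟨ +-monoʳ-≤ 1 (timesChosen≤infected (<⇒≤ k<T) u) ⟩
      1 + χ (A k u)        ≡⟨ cong (λ b → 1 + χ b) (newlyInfected-healthy k<T) ⟩
      1                    ≡⟨ cong χ (newlyInfected-infected k<T) ⟨
      χ (A (suc k) u)      ∎
      where open ≤-Reasoning
    ... | no _     = ≤-trans (timesChosen≤infected (<⇒≤ k<T) u) (χ-mono (step-inflationary r (A k)))

    T≤2^d : T ≤ 2 ^ d
    T≤2^d = begin
      T                         ≡⟨ *-identityʳ T ⟨
      T * 1                     ≡⟨ ∑-downFrom-const T 1 ⟨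
      ∑[ s ∈ downFrom T ] 1     ≡⟨ ∑-fibres (downFrom T) newlyInfected (λ _ _ → 1) ⟩
      ∑[ w ∈ allVertices d ] ∑[ s ∈ downFrom T ] (δ (newlyInfected s) w * 1)
        ≡⟨ ∑-cong (λ w → ∑-distribʳ-* (λ s → δ (newlyInfected s) w) 1 (downFrom T))
                  (allVertices d) ⟩
      ∑[ w ∈ allVertices d ] (timesChosen T w * 1)
        ≤⟨ ∑-mono chosenAtMostOnce (allVertices d) ⟩
      ∑[ w ∈ allVertices d ] 1  ≡⟨ ∑-allVertices-const d 1 ⟩
      2 ^ d * 1                 ≡⟨ *-identityʳ (2 ^ d) ⟩
      2 ^ d                     ∎
      where
      open ≤-Reasoning
      chosenAtMostOnce : ∀ w → timesChosen T w * 1 ≤ 1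
      chosenAtMostOnce w =
        ≤-trans (*-χ≤ (timesChosen T w) true) (≤-trans (timesChosen≤infected ≤-refl w) (χ≤1 _))

    adjacentChosen : ℕ → Vertex d → ℕ
    adjacentChosen k w = ∑[ s ∈ downFrom k ] adjacency (newlyInfected s) w

    adjacentChosen≤steps : ∀ k w → adjacentChosen k w ≤ k
    adjacentChosen≤steps k w = begin
      adjacentChosen k w          ≤⟨ ∑-mono (λ s → adjacency≤1 (newlyInfected s) w) (downFrom k) ⟩
      ∑[ s ∈ downFrom k ] 1       ≡⟨ ∑-downFrom-const k 1 ⟩
      k * 1                       ≡⟨ *-identityʳ k ⟩
      k                           ∎
      where open ≤-Reasoning

    adjacentChosen≤infectedNeighbours : ∀ {k} → k ≤ T → ∀ w →
                                        adjacentChosen k w ≤ infectedNeighbours (A k) w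
    adjacentChosen≤infectedNeighbours {k} k≤T w = begin
      ∑[ s ∈ downFrom k ] ∑[ i ∈ allFin d ] δ (flipAt i (newlyInfected s)) w
        ≡⟨ ∑-cong (λ s → ∑-cong (λ i → δ-flipAt i (newlyInfected s) w) (allFin d)) (downFrom k) ⟩
      ∑[ s ∈ downFrom k ] ∑[ i ∈ allFin d ] δ (newlyInfected s) (flipAt i w)
        ≡⟨ ∑-comm (downFrom k) (allFin d) (λ s i → δ (newlyInfected s) (flipAt i w)) ⟩
      ∑[ i ∈ allFin d ] timesChosen k (flipAt i w)
        ≤⟨ ∑-mono (λ i → timesChosen≤infected k≤T (flipAt i w)) (allFin d) ⟩
      infectedNeighbours (A k) w
        ∎
      where open ≤-Reasoning

    adjacentChosen-healthy : ∀ k → suc k ≤ T → ∀ w →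
                             infectedBefore k w ≡ false → adjacentChosen (suc k) w ≤ r + 2
    adjacentChosen-healthy zero          _   w _       =
      ≤-trans (adjacentChosen≤steps 1 w) (≤-trans (n≤1+n 1) (m≤n+m 2 r))
    adjacentChosen-healthy (suc zero)    _   w _       =
      ≤-trans (adjacentChosen≤steps 2 w) (m≤n+m 2 r)
    adjacentChosen-healthy (suc (suc j)) j<T w healthy = begin
      adjacency (v (2 + j)) w + (adjacency (v (1 + j)) w + (adjacency (v j) w + adjacentChosen j w))
        ≤⟨ +-mono-≤ (adjacency≤1 (v (2 + j)) w)
                    (+-mono-≤ (adjacency≤1 (v (1 + j)) w) (+-monoˡ-≤ _ (adjacency≤1 (v j) w))) ⟩
      3 + adjacentChosen j w  ≤⟨ +-monoʳ-≤ 2 few ⟩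
      2 + r                   ≡⟨ +-comm 2 r ⟩
      r + 2                   ∎
      where
      open ≤-Reasoning
      v = newlyInfected
      few : adjacentChosen j w < r
      few = ≤-<-trans (adjacentChosen≤infectedNeighbours (≤-trans (m≤n+m j 3) j<T) w)
                      (step-false⇒infectedNeighbours< r (A j) w healthy)

    healthyAdjacentChosen : ℕ → Vertex d → ℕ
    healthyAdjacentChosen k w =
      ∑[ s ∈ downFrom k ] (adjacency (newlyInfected s) w * χ (not (infectedBefore s w)))

    healthyAdjacentChosen≤ : ∀ k → k ≤ T → ∀ w → healthyAdjacentChosen k w ≤ r + 2
    healthyAdjacentChosen≤ zero    _   w = z≤n
    healthyAdjacentChosen≤ (suc k) k<T w with infectedBefore k w in infected
    ... | true  = begin
      adjacency (newlyInfected k) w * 0 + healthyAdjacentChosen k w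
        ≡⟨ cong (_+ healthyAdjacentChosen k w) (*-zeroʳ (adjacency (newlyInfected k) w)) ⟩
      healthyAdjacentChosen k w
        ≤⟨ healthyAdjacentChosen≤ k (<⇒≤ k<T) w ⟩
      r + 2 ∎
      where open ≤-Reasoning
    ... | false = ≤-trans (+-mono-≤ (*-χ≤ (adjacency (newlyInfected k) w) true)
                                   (∑-mono (λ s → *-χ≤ (adjacency (newlyInfected s) w) _) (downFrom k)))
                          (adjacentChosen-healthy k k<T w infected)

    infectedBeforeNeighbours≤r : ∀ {s} → s < T →
                                 infectedNeighbours (infectedBefore s) (newlyInfected s) ≤ r
    infectedBeforeNeighbours≤r {zero}  _   = ≤-trans (≤-reflexive (∑-zero (allFin d))) z≤n
    infectedBeforeNeighbours≤r {suc s} s<T =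
      <⇒≤ (step-false⇒infectedNeighbours< r (A s) (newlyInfected (suc s)) (newlyInfected-healthy s<T))

    percolationTime-bound : T * d ≤ (2 * r + 2) * 2 ^ d
    percolationTime-bound = begin
      T * d                            ≡⟨ ∑-downFrom-const T d ⟨
      ∑[ s ∈ downFrom T ] d            ≡⟨ ∑-cong split (downFrom T) ⟨
      ∑[ s ∈ downFrom T ] (infected s + healthy s)
                                       ≡⟨ ∑-distrib-+ infected healthy (downFrom T) ⟩
      ∑ (downFrom T) infected + ∑ (downFrom T) healthy
                                       ≤⟨ +-mono-≤ alreadyInfected stillHealthy ⟩
      T * r + (r + 2) * 2 ^ d          ≤⟨ +-monoˡ-≤ _ (*-monoˡ-≤ r T≤2^d) ⟩
      2 ^ d * r + (r + 2) * 2 ^ d      ≡⟨ collect r (2 ^ d) ⟩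
      (2 * r + 2) * 2 ^ d              ∎
      where
      open ≤-Reasoning
      v = newlyInfected
      B = infectedBefore

      infected healthy : ℕ → ℕ
      infected s = infectedNeighbours (B s) (v s)
      healthy  s = infectedNeighbours (not ∘ B s) (v s)

      split : ∀ s → infected s + healthy s ≡ d
      split s = infectedNeighbours-complement (B s) (v s)

      alreadyInfected : ∑ (downFrom T) infected ≤ T * r
      alreadyInfected = begin
        ∑ (downFrom T) infected
          ≤⟨ ∑-mono-∈ (downFrom T) (infectedBeforeNeighbours≤r ∘ ∈-downFrom⁻) ⟩
        ∑[ s ∈ downFrom T ] r  ≡⟨ ∑-downFrom-const T r ⟩
        T * r                  ∎

      stillHealthy : ∑ (downFrom T) healthy ≤ (r + 2) * 2 ^ d
      stillHealthy = begin
        ∑ (downFrom T) healthy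
          ≡⟨ ∑-infectedNeighbours (downFrom T) v (λ s → not ∘ B s) ⟩
        ∑ (allVertices d) (healthyAdjacentChosen T)
          ≤⟨ ∑-mono (healthyAdjacentChosen≤ T ≤-refl) (allVertices d) ⟩
        ∑[ w ∈ allVertices d ] (r + 2)      ≡⟨ ∑-allVertices-const d (r + 2) ⟩
        2 ^ d * (r + 2)                     ≡⟨ *-comm (2 ^ d) (r + 2) ⟩
        (r + 2) * 2 ^ d                     ∎

      collect : ∀ r n → n * r + (r + 2) * n ≡ (2 * r + 2) * n
      collect = solve-∀

-- The bound holds for every r and d.
lemma3p4 : (r : ℕ) → 3 ≤ r → (d : ℕ) → r ≤ d →
    (A₀ : VSet d) (T : ℕ) → PercolationTime r A₀ T →
    T * d ≤ (4 * r + 2) * 2 ^ d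
lemma3p4 r _ d _ A₀ T perc = begin
  T * d                ≤⟨ percolationTime-bound ⟩
  (2 * r + 2) * 2 ^ d  ≤⟨ *-monoˡ-≤ (2 ^ d) (+-monoˡ-≤ 2 (*-monoˡ-≤ r (m≤m+n 2 2))) ⟩
  (4 * r + 2) * 2 ^ d  ∎
  where
  open ≤-Reasoning
  open Percolation r A₀
  open Percolating perc
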